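{- Let $B$ be a minimum-weight basis of a weighted uncertainty matroid $\mathcal{M}=(E,\mathcal{I},A,w)$ and let $Q$ be a set that verifies $B$. Let $e\notin B$ and $e'\in B$ with $L_e=L_{e'}=w_e=w_{e'}$ be such that $e'\in C_e$, where $C_e$ is the fundamental circuit of $e$ with respect to $B$. Then $Q'=(Q\setminus\{e'\})\cup\{e\}$ is a certificate that verifies $B'=(B\cup\{e\})\setminus\{e'\}$.
   Context: A weighted uncertainty matroid $\mathcal{M}=(E,\mathcal{I},A,w)$ consists of a matroid $(E,\mathcal{I})$ on a finite set $E$, for each $e$ an uncertainty area $A_e\subseteq\mathbb{R}$ (a non-empty finite union of bounded real intervals, open or closed, single points allowed), and a weight $w_e\in A_e$; $L_e=\inf A_e$, $U_e=\sup A_e$. For a basis $B$ and $f\notin B$, the fundamental circuit $C_f$ is the unique circuit contained in $B\cup\{f\}$. A minimum-weight basis (MWB) minimizes $\sum_{e\in B}w_e$. A weight assignment consistent with $Q$ is $w^*$ with $w^*_e\in A_e$ for all $e$ and $w^*_e=w_e$ for $e\in Q$. $Q$ verifies the MWB $B$ (is a certificate for $B$) if for every weight assignment $w^*$ consistent with $Q$, $B$ is an MWB of $(E,\mathcal{I},w^*)$. -}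

module Defs where

open import Level using (Level; _⊔_) renaming (suc to lsuc)
open import Data.Nat using (ℕ; zero; suc) renaming (_<_ to _<ℕ_)
open import Data.Bool using (Bool; true; false)
open import Data.Fin using (Fin)
import Data.Fin as Fin
open import Data.Fin.Subset using (Subset; _∈_; _∉_; _⊆_; _⊂_; _∪_; _-_; ⁅_⁆; ∣_∣; ⊥; inside; outside)
open import Data.Vec using (Vec; []; _∷_)
open import Data.List.NonEmpty using (List⁺; toList)
open import Data.List.Relation.Unary.Any using (Any)
open import Data.Product using (Σ; _×_; ∃; ∃-syntax)
open import Relation.Nullary using (¬_)
open import Relation.Binary.PropositionalEquality using (_≡_)
open import Relation.Binary.Structures using (IsTotalOrder)
open import Algebra.Structures using (IsAbelianGroup)

-- The number domain for weights.  Agda's stdlib has no real numbers, so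
-- we work over an arbitrary totally ordered abelian group (ℝ with + and ≤
-- is an instance).

record OrderedAbelianGroup (c ℓ : Level) : Set (lsuc (c ⊔ ℓ)) where
  infixl 6 _+_
  infix 4 _≤_ _<_
  field
    Carrier : Set c
    _+_     : Carrier → Carrier → Carrier
    0#      : Carrier
    neg     : Carrier → Carrier
    _≤_     : Carrier → Carrier → Set ℓ
    isAbelianGroup : IsAbelianGroup _≡_ _+_ 0# neg
    isTotalOrder   : IsTotalOrder _≡_ _≤_
    +-monoˡ-≤      : ∀ {x y} z → x ≤ y → x + z ≤ y + z

  _<_ : Carrier → Carrier → Set (c ⊔ ℓ)
  x < y = x ≤ y × ¬ (x ≡ y)

record Matroid (n : ℕ) : Set₁ where
  field
    Indep       : Subset n → Set
    indep-∅     : Indep ⊥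
    indep-⊆     : ∀ {I J} → J ⊆ I → Indep I → Indep J
    indep-aug   : ∀ {I J} → Indep I → Indep J → ∣ I ∣ <ℕ ∣ J ∣ →
                  ∃[ x ] (x ∈ J × x ∉ I × Indep (I ∪ ⁅ x ⁆))

module _ {n : ℕ} (M : Matroid n) where
  open Matroid M

  IsBasis : Subset n → Set
  IsBasis B = Indep B × (∀ J → Indep J → B ⊆ J → J ⊆ B)

  IsCircuit : Subset n → Set
  IsCircuit C = ¬ Indep C × (∀ D → D ⊂ C → Indep D)

  IsFundamentalCircuit : Subset n → Fin n → Subset n → Set
  IsFundamentalCircuit B f C = IsCircuit C × C ⊆ B ∪ ⁅ f ⁆

module _ {c ℓ : Level} (G : OrderedAbelianGroup c ℓ) where
  open OrderedAbelianGroup G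

  weightOf : ∀ {n} → (Fin n → Carrier) → Subset n → Carrier
  weightOf {zero}  w []             = 0#
  weightOf {suc n} w (inside  ∷ p) = w Fin.zero + weightOf (λ i → w (Fin.suc i)) p
  weightOf {suc n} w (outside ∷ p) = weightOf (λ i → w (Fin.suc i)) p

  -- a bounded interval with endpoints lo ≤ hi; each end open or closed
  -- (lo = hi with both ends closed gives a single point)
  record Interval : Set (c ⊔ ℓ) where
    field
      lo hi     : Carrier
      lo≤hi     : lo ≤ hi
      loClosed  : Bool
      hiClosed  : Bool

  LowerOK : Bool → Carrier → Carrier → Set (c ⊔ ℓ)
  LowerOK true  l x = Level.Lift c (l ≤ x)
  LowerOK false l x = Level.Lift c (l < x)

  UpperOK : Bool → Carrier → Carrier → Set (c ⊔ ℓ)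
  UpperOK true  h x = Level.Lift c (x ≤ h)
  UpperOK false h x = Level.Lift c (x < h)

  _∈I_ : Carrier → Interval → Set (c ⊔ ℓ)
  x ∈I I = LowerOK (Interval.loClosed I) (Interval.lo I) x
         × UpperOK (Interval.hiClosed I) (Interval.hi I) x

  UncertaintyArea : Set (c ⊔ ℓ)
  UncertaintyArea = List⁺ Interval

  _∈A_ : Carrier → UncertaintyArea → Set (c ⊔ ℓ)
  x ∈A A = Any (x ∈I_) (toList A)

  IsInf : UncertaintyArea → Carrier → Set (c ⊔ ℓ)
  IsInf A L = (∀ x → x ∈A A → L ≤ x)
            × (∀ y → (∀ x → x ∈A A → y ≤ x) → y ≤ L)

  record WUMatroid (n : ℕ) : Set (lsuc (c ⊔ ℓ)) where
    field
      matroid : Matroid n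
      area    : Fin n → UncertaintyArea
      w       : Fin n → Carrier
      w∈A     : ∀ e → w e ∈A area e

  module _ {n : ℕ} (𝓜 : WUMatroid n) where
    open WUMatroid 𝓜

    IsMWB : (Fin n → Carrier) → Subset n → Set (c ⊔ ℓ)
    IsMWB w* B = Level.Lift (c ⊔ ℓ) (IsBasis matroid B)
               × (∀ B′ → IsBasis matroid B′ → weightOf w* B ≤ weightOf w* B′)

    Consistent : Subset n → (Fin n → Carrier) → Set (c ⊔ ℓ)
    Consistent Q w* = (∀ e → w* e ∈A area e) × (∀ e → e ∈ Q → w* e ≡ w e)

    Verifies : Subset n → Subset n → Set (c ⊔ ℓ)
    Verifies Q B = ∀ (w* : Fin n → Carrier) → Consistent Q w* → IsMWB w* B

-- After the exchange, B′ has the same weight as B under every weight assignment that gives e and e′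
-- equal weights.  Given a weight assignment w* consistent with Q′, reset the weight of e′ to its true
-- value w e′ = L_e′; the result w″ is consistent with Q, so B is minimum for w″.  Since w″ ≤ w*
-- pointwise and w″ agrees with w* on B′ (which avoids e′), and w″ e = w* e = w e = w e′ = w″ e′,
-- every basis B″ satisfies  w*(B′) = w″(B′) = w″(B) ≤ w″(B″) ≤ w*(B″).
module Submission where

open import Defs
open import Level using (Level; lift)
open import Data.Nat using (ℕ; zero; suc)
import Data.Nat.Properties as ℕ
open import Data.Fin using (Fin)
import Data.Fin as Fin
open import Data.Fin.Properties using (_≟_)
open import Data.Fin.Subset using (Subset; _∈_; _∉_; _⊆_; _∪_; _-_; ⁅_⁆; ∣_∣; inside; outside)
open import Data.Fin.Subset.Properties
open import Data.Vec using ([]; _∷_; here; there)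
open import Data.Vec.Functional using (updateAt)
open import Data.Vec.Functional.Properties using (updateAt-updates; updateAt-minimal)
open import Data.Product using (_×_; _,_; ∃-syntax; proj₁)
open import Data.Sum using (inj₁; inj₂)
open import Function using (_∘_; const)
open import Relation.Nullary using (¬_; yes; no; contradiction)
open import Relation.Binary.PropositionalEquality
open import Relation.Binary.Structures using (IsTotalOrder)
open import Algebra.Bundles using (AbelianGroup)
import Algebra.Properties.AbelianGroup as AbelianGroupProperties
import Algebra.Properties.CommutativeSemigroup as CommutativeSemigroupProperties

private variable m : ℕ

module _ where
  open import Data.Nat using (_+_; _≤_; _<_; z≤n; s≤s)

  ∣p∪⁅x⁆∣≡1+∣p∣ : ∀ {x : Fin m} {p : Subset m} → x ∉ p → ∣ p ∪ ⁅ x ⁆ ∣ ≡ suc ∣ p ∣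
  ∣p∪⁅x⁆∣≡1+∣p∣ {x = Fin.zero}  {p = inside  ∷ p} x∉p = contradiction here x∉p
  ∣p∪⁅x⁆∣≡1+∣p∣ {x = Fin.zero}  {p = outside ∷ p} x∉p = cong (suc ∘ ∣_∣) (∪-identityʳ p)
  ∣p∪⁅x⁆∣≡1+∣p∣ {x = Fin.suc x} {p = inside  ∷ p} x∉p = cong suc (∣p∪⁅x⁆∣≡1+∣p∣ (x∉p ∘ there))
  ∣p∪⁅x⁆∣≡1+∣p∣ {x = Fin.suc x} {p = outside ∷ p} x∉p = ∣p∪⁅x⁆∣≡1+∣p∣ (x∉p ∘ there)

  1+∣p-x∣≡∣p∣ : ∀ {x : Fin m} {p : Subset m} → x ∈ p → suc ∣ p - x ∣ ≡ ∣ p ∣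
  1+∣p-x∣≡∣p∣ {x = Fin.zero}  {p = inside  ∷ p} here        = cong (suc ∘ ∣_∣) (p─⊥≡p p)
  1+∣p-x∣≡∣p∣ {x = Fin.suc x} {p = inside  ∷ p} (there x∈p) = cong suc (1+∣p-x∣≡∣p∣ x∈p)
  1+∣p-x∣≡∣p∣ {x = Fin.suc x} {p = outside ∷ p} (there x∈p) = 1+∣p-x∣≡∣p∣ x∈p

  x∈p-y⇒x≢y : ∀ {x y : Fin m} (p : Subset m) → x ∈ p - y → x ≢ y
  x∈p-y⇒x≢y {x = Fin.zero}  (_ ∷ p) ()          refl
  x∈p-y⇒x≢y {x = Fin.suc x} (_ ∷ p) (there x∈p) refl = x∈p-y⇒x≢y p x∈p refl

  p⊆q∧∣q∣≤∣p∣⇒q⊆p : ∀ {p q : Subset m} → p ⊆ q → ∣ q ∣ ≤ ∣ p ∣ → q ⊆ p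
  p⊆q∧∣q∣≤∣p∣⇒q⊆p {p = p} p⊆q ∣q∣≤∣p∣ {x} x∈q with x ∈? p
  ... | yes x∈p = x∈p
  ... | no  x∉p = contradiction ∣q∣≤∣p∣ (ℕ.<⇒≱ (p⊂q⇒∣p∣<∣q∣ (p⊆q , x , x∈q , x∉p)))

  ∣[p∪⁅x⁆]-y∣≡∣p∣ : ∀ {x y : Fin m} {p : Subset m} → x ∉ p → y ∈ p → ∣ (p ∪ ⁅ x ⁆) - y ∣ ≡ ∣ p ∣
  ∣[p∪⁅x⁆]-y∣≡∣p∣ {x = x} x∉p y∈p =
    ℕ.suc-injective (trans (1+∣p-x∣≡∣p∣ (p⊆p∪q ⁅ x ⁆ y∈p)) (∣p∪⁅x⁆∣≡1+∣p∣ x∉p))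

  module _ {n : ℕ} (M : Matroid n) where
    open Matroid M

    indep-augment : ∀ k {I J : Subset n} → Indep I → Indep J → ∣ I ∣ + k ≡ ∣ J ∣ →
                    ∃[ S ] (Indep S × I ⊆ S × S ⊆ I ∪ J × ∣ S ∣ ≡ ∣ J ∣)
    indep-augment zero    {I} {J} iI iJ eq =
      I , iI , ⊆-refl , p⊆p∪q J , trans (sym (ℕ.+-identityʳ ∣ I ∣)) eq
    indep-augment (suc k) {I} {J} iI iJ eq
      with x , x∈J , x∉I , iI∪x ← indep-aug iI iJ (subst (∣ I ∣ <_) eq (ℕ.m<m+n ∣ I ∣ (s≤s z≤n)))
      with S , iS , I∪x⊆S , S⊆I∪x∪J , ∣S∣≡∣J∣ ← indep-augment k iI∪x iJ
             (trans (cong (_+ k) (∣p∪⁅x⁆∣≡1+∣p∣ x∉I)) (trans (sym (ℕ.+-suc ∣ I ∣ k)) eq))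
      = S , iS , I∪x⊆S ∘ p⊆p∪q ⁅ x ⁆ , I∪x∪J⊆I∪J ∘ S⊆I∪x∪J , ∣S∣≡∣J∣
      where
      I∪x∪J⊆I∪J : (I ∪ ⁅ x ⁆) ∪ J ⊆ I ∪ J
      I∪x∪J⊆I∪J y∈ with x∈p∪q⁻ (I ∪ ⁅ x ⁆) J y∈
      ... | inj₂ y∈J = q⊆p∪q I J y∈J
      ... | inj₁ y∈I∪x with x∈p∪q⁻ I ⁅ x ⁆ y∈I∪x
      ...   | inj₁ y∈I = p⊆p∪q J y∈I
      ...   | inj₂ y∈x rewrite x∈⁅y⁆⇒x≡y x y∈x = q⊆p∪q I J x∈J

    indep-∣J∣≤∣B∣ : ∀ {B J} → IsBasis M B → Indep J → ∣ J ∣ ≤ ∣ B ∣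
    indep-∣J∣≤∣B∣ {B} {J} (iB , maxB) iJ = ℕ.≮⇒≥ ∣B∣≮∣J∣
      where
      ∣B∣≮∣J∣ : ¬ ∣ B ∣ < ∣ J ∣
      ∣B∣≮∣J∣ ∣B∣<∣J∣ with x , _ , x∉B , iB∪x ← indep-aug iB iJ ∣B∣<∣J∣ =
        x∉B (maxB (B ∪ ⁅ x ⁆) iB∪x (p⊆p∪q ⁅ x ⁆) (q⊆p∪q B ⁅ x ⁆ (x∈⁅x⁆ x)))

    indep∧∣B∣≤∣J∣⇒basis : ∀ {B J} → IsBasis M B → Indep J → ∣ B ∣ ≤ ∣ J ∣ → IsBasis M J
    indep∧∣B∣≤∣J∣⇒basis basB iJ ∣B∣≤∣J∣ = iJ , λ K iK J⊆K →
      p⊆q∧∣q∣≤∣p∣⇒q⊆p J⊆K (ℕ.≤-trans (indep-∣J∣≤∣B∣ basB iK) ∣B∣≤∣J∣)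

    basis-∣B∣≡∣B′∣ : ∀ {B B′} → IsBasis M B → IsBasis M B′ → ∣ B ∣ ≡ ∣ B′ ∣
    basis-∣B∣≡∣B′∣ basB basB′ =
      ℕ.≤-antisym (indep-∣J∣≤∣B∣ basB′ (proj₁ basB)) (indep-∣J∣≤∣B∣ basB (proj₁ basB′))

    indep-extends-to-basis : ∀ {B I} → IsBasis M B → Indep I → ∃[ S ] (IsBasis M S × I ⊆ S × S ⊆ I ∪ B)
    indep-extends-to-basis basB@(iB , _) iI
      with S , iS , I⊆S , S⊆I∪B , ∣S∣≡∣B∣ ← indep-augment _ iI iB (ℕ.m+[n∸m]≡n (indep-∣J∣≤∣B∣ basB iI))
      = S , indep∧∣B∣≤∣J∣⇒basis basB iS (ℕ.≤-reflexive (sym ∣S∣≡∣B∣)) , I⊆S , S⊆I∪B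

    -- Extending C - e′ to a basis inside (C - e′) ∪ B can never pick up e′ (that would complete the
    -- dependent set C), so the extension lies in B′ and, having the size of a basis, is B′.
    basis-exchange : ∀ {B C e e′} → IsBasis M B → e ∉ B → e′ ∈ B →
                     IsFundamentalCircuit M B e C → e′ ∈ C → IsBasis M ((B ∪ ⁅ e ⁆) - e′)
    basis-exchange {B} {C} {e} {e′} basB e∉B e′∈B ((¬iC , minC) , C⊆B∪e) e′∈C
      with S , basS , C-e′⊆S , S⊆C-e′∪B ← indep-extends-to-basis basB (minC (C - e′) (x∈p⇒p-x⊂p e′∈C))
      = subst (IsBasis M) S≡B′ basS
      where
      B′ = (B ∪ ⁅ e ⁆) - e′
      C-e′⊆B′ : C - e′ ⊆ B′
      C-e′⊆B′ y∈ = x∈p∧x≢y⇒x∈p-y (C⊆B∪e (p─q⊆p C ⁅ e′ ⁆ y∈)) (x∈p-y⇒x≢y C y∈)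
      e′∉S : e′ ∉ S
      e′∉S e′∈S = ¬iC (indep-⊆ C⊆S (proj₁ basS))
        where
        C⊆S : C ⊆ S
        C⊆S {y} y∈C with y ≟ e′
        ... | yes refl = e′∈S
        ... | no  y≢e′ = C-e′⊆S (x∈p∧x≢y⇒x∈p-y y∈C y≢e′)
      S⊆B′ : S ⊆ B′
      S⊆B′ {y} y∈S with x∈p∪q⁻ (C - e′) B (S⊆C-e′∪B y∈S)
      ... | inj₁ y∈C-e′ = C-e′⊆B′ y∈C-e′
      ... | inj₂ y∈B    = x∈p∧x≢y⇒x∈p-y (p⊆p∪q ⁅ e ⁆ y∈B) (λ { refl → e′∉S y∈S })
      S≡B′ : S ≡ B′
      S≡B′ = ⊆-antisym S⊆B′ (p⊆q∧∣q∣≤∣p∣⇒q⊆p S⊆B′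
               (ℕ.≤-reflexive (trans (∣[p∪⁅x⁆]-y∣≡∣p∣ e∉B e′∈B) (basis-∣B∣≡∣B′∣ basB basS))))

module _ {c ℓ : Level} (G : OrderedAbelianGroup c ℓ) where
  open OrderedAbelianGroup G
  open IsTotalOrder isTotalOrder using () renaming (refl to ≤-refl; trans to ≤-trans)

  private
    abelianGroup : AbelianGroup c c
    abelianGroup = record { isAbelianGroup = isAbelianGroup }

  open AbelianGroupProperties abelianGroup using (∙-cancelˡ)
  open CommutativeSemigroupProperties (AbelianGroup.commutativeSemigroup abelianGroup)
    using (x∙yz≈y∙xz)
  open AbelianGroup abelianGroup using (comm)

  +-mono-≤ : ∀ {x y a b} → x ≤ y → a ≤ b → x + a ≤ y + b
  +-mono-≤ {x} {y} {a} {b} x≤y a≤b =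
    ≤-trans (+-monoˡ-≤ a x≤y) (subst₂ _≤_ (comm a y) (comm b y) (+-monoˡ-≤ y a≤b))

  weightOf-insert : (w : Fin m → Carrier) {x : Fin m} {p : Subset m} → x ∉ p →
                    weightOf G w (p ∪ ⁅ x ⁆) ≡ w x + weightOf G w p
  weightOf-insert w {Fin.zero}  {inside  ∷ p} x∉p = contradiction here x∉p
  weightOf-insert w {Fin.zero}  {outside ∷ p} x∉p =
    cong (λ q → w Fin.zero + weightOf G (w ∘ Fin.suc) q) (∪-identityʳ p)
  weightOf-insert w {Fin.suc x} {inside  ∷ p} x∉p =
    trans (cong (w Fin.zero +_) (weightOf-insert (w ∘ Fin.suc) (x∉p ∘ there))) (x∙yz≈y∙xz _ _ _)
  weightOf-insert w {Fin.suc x} {outside ∷ p} x∉p = weightOf-insert (w ∘ Fin.suc) (x∉p ∘ there)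

  weightOf-remove : (w : Fin m → Carrier) {x : Fin m} {p : Subset m} → x ∈ p →
                    w x + weightOf G w (p - x) ≡ weightOf G w p
  weightOf-remove w {Fin.zero}  {inside  ∷ p} here =
    cong (λ q → w Fin.zero + weightOf G (w ∘ Fin.suc) q) (p─⊥≡p p)
  weightOf-remove w {Fin.suc x} {inside  ∷ p} (there x∈p) =
    trans (x∙yz≈y∙xz _ _ _) (cong (w Fin.zero +_) (weightOf-remove (w ∘ Fin.suc) x∈p))
  weightOf-remove w {Fin.suc x} {outside ∷ p} (there x∈p) = weightOf-remove (w ∘ Fin.suc) x∈p

  weightOf-cong : ∀ {u v : Fin m → Carrier} (p : Subset m) → (∀ i → i ∈ p → u i ≡ v i) →
                  weightOf G u p ≡ weightOf G v p
  weightOf-cong []            u≡v = refl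
  weightOf-cong (inside  ∷ p) u≡v =
    cong₂ _+_ (u≡v Fin.zero here) (weightOf-cong p (λ i → u≡v (Fin.suc i) ∘ there))
  weightOf-cong (outside ∷ p) u≡v = weightOf-cong p (λ i → u≡v (Fin.suc i) ∘ there)

  weightOf-mono : ∀ {u v : Fin m → Carrier} (p : Subset m) → (∀ i → u i ≤ v i) →
                  weightOf G u p ≤ weightOf G v p
  weightOf-mono []            u≤v = ≤-refl
  weightOf-mono (inside  ∷ p) u≤v = +-mono-≤ (u≤v Fin.zero) (weightOf-mono p (u≤v ∘ Fin.suc))
  weightOf-mono (outside ∷ p) u≤v = weightOf-mono p (u≤v ∘ Fin.suc)

  weightOf-exchange : (w : Fin m → Carrier) {x y : Fin m} {p : Subset m} →
                      x ∉ p → y ∈ p → w x ≡ w y → weightOf G w ((p ∪ ⁅ x ⁆) - y) ≡ weightOf G w p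
  weightOf-exchange w {x} {y} {p} x∉p y∈p wx≡wy = ∙-cancelˡ (w y) _ _ (begin
    w y + weightOf G w ((p ∪ ⁅ x ⁆) - y) ≡⟨ weightOf-remove w (p⊆p∪q ⁅ x ⁆ y∈p) ⟩
    weightOf G w (p ∪ ⁅ x ⁆)             ≡⟨ weightOf-insert w x∉p ⟩
    w x + weightOf G w p                 ≡⟨ cong (_+ weightOf G w p) wx≡wy ⟩
    w y + weightOf G w p                 ∎)
    where open ≡-Reasoning

module _ {c ℓ : Level} (G : OrderedAbelianGroup c ℓ) {n : ℕ} (𝓜 : WUMatroid G n) where
  open OrderedAbelianGroup G
  open WUMatroid 𝓜
  open IsTotalOrder isTotalOrder using (reflexive) renaming (trans to ≤-trans)

  consistent-⊆ : ∀ {Q Q′ w*} → Q ⊆ Q′ → Consistent G 𝓜 Q′ w* → Consistent G 𝓜 Q w*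
  consistent-⊆ Q⊆Q′ (w*∈A , w*≡w) = w*∈A , λ i → w*≡w i ∘ Q⊆Q′

  resetAt : (Fin n → Carrier) → Fin n → Fin n → Carrier
  resetAt w* e = updateAt w* e (const (w e))

  resetAt-consistent : ∀ {Q w*} e → Consistent G 𝓜 (Q - e) w* → Consistent G 𝓜 Q (resetAt w* e)
  resetAt-consistent {Q} {w*} e (w*∈A , w*≡w) = reset∈A , reset≡w
    where
    reset∈A : ∀ i → _∈A_ G (resetAt w* e i) (area i)
    reset∈A i with i ≟ e
    ... | yes refl = subst (λ x → _∈A_ G x (area i)) (sym (updateAt-updates i w*)) (w∈A i)
    ... | no  i≢e  = subst (λ x → _∈A_ G x (area i)) (sym (updateAt-minimal i e w* i≢e)) (w*∈A i)
    reset≡w : ∀ i → i ∈ Q → resetAt w* e i ≡ w i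
    reset≡w i i∈Q with i ≟ e
    ... | yes refl = updateAt-updates i w*
    ... | no  i≢e  = trans (updateAt-minimal i e w* i≢e) (w*≡w i (x∈p∧x≢y⇒x∈p-y i∈Q i≢e))

  resetAt-≤ : ∀ {w*} e → IsInf G (area e) (w e) → _∈A_ G (w* e) (area e) → ∀ i → resetAt w* e i ≤ w* i
  resetAt-≤ {w*} e (w-lower , _) w*e∈A i with i ≟ e
  ... | yes refl = subst (_≤ w* i) (sym (updateAt-updates i w*)) (w-lower (w* i) w*e∈A)
  ... | no  i≢e  = reflexive (updateAt-minimal i e w* i≢e)

  isMWB-of-lighter : ∀ {u v B B′} → IsMWB G 𝓜 v B → (∀ i → v i ≤ u i) → IsBasis matroid B′ →
                     weightOf G u B′ ≡ weightOf G v B → IsMWB G 𝓜 u B′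
  isMWB-of-lighter {u} (_ , B-min) v≤u basB′ uB′≡vB = lift basB′ , λ B″ basB″ →
    subst (_≤ weightOf G u B″) (sym uB′≡vB)
      (≤-trans (B-min B″ basB″) (weightOf-mono G B″ v≤u))

lemma2p11 : ∀ {c ℓ : Level} (G : OrderedAbelianGroup c ℓ) {n : ℕ}
    (𝓜 : WUMatroid G n) (B Q : Subset n) (e e′ : Fin n) →
    IsMWB G 𝓜 (WUMatroid.w 𝓜) B →
    Verifies G 𝓜 Q B →
    e ∉ B → e′ ∈ B →
    IsInf G (WUMatroid.area 𝓜 e) (WUMatroid.w 𝓜 e) →
    IsInf G (WUMatroid.area 𝓜 e′) (WUMatroid.w 𝓜 e′) →
    WUMatroid.w 𝓜 e ≡ WUMatroid.w 𝓜 e′ →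
    (∃[ C ] (IsFundamentalCircuit (WUMatroid.matroid 𝓜) B e C × e′ ∈ C)) →
    Verifies G 𝓜 ((Q - e′) ∪ ⁅ e ⁆) ((B ∪ ⁅ e ⁆) - e′)
lemma2p11 G 𝓜 B Q e e′ (lift basB , _) Q-verifies e∉B e′∈B _ inf-e′ we≡we′ (C , fc-C , e′∈C)
          w* w*-consistent@(w*∈A , w*≡w) =
  isMWB-of-lighter G 𝓜 (Q-verifies w″ w″-consistent) (resetAt-≤ G 𝓜 e′ inf-e′ (w*∈A e′))
    (basis-exchange matroid basB e∉B e′∈B fc-C e′∈C) w*B′≡w″B
  where
  open WUMatroid 𝓜
  open ≡-Reasoning
  w″ = resetAt G 𝓜 w* e′
  w″-consistent : Consistent G 𝓜 Q w″
  w″-consistent = resetAt-consistent G 𝓜 e′ (consistent-⊆ G 𝓜 (p⊆p∪q ⁅ e ⁆) w*-consistent)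
  w″e≡w″e′ : w″ e ≡ w″ e′
  w″e≡w″e′ = begin
    w″ e    ≡⟨ updateAt-minimal e e′ w* (λ { refl → e∉B e′∈B }) ⟩
    w* e    ≡⟨ w*≡w e (q⊆p∪q (Q - e′) ⁅ e ⁆ (x∈⁅x⁆ e)) ⟩
    w e     ≡⟨ we≡we′ ⟩
    w e′    ≡⟨ updateAt-updates e′ w* ⟨
    w″ e′   ∎
  w*B′≡w″B : weightOf G w* ((B ∪ ⁅ e ⁆) - e′) ≡ weightOf G w″ B
  w*B′≡w″B = begin
    weightOf G w* ((B ∪ ⁅ e ⁆) - e′) ≡⟨ weightOf-cong G _ (λ i i∈B′ →
                                          sym (updateAt-minimal i e′ w* (x∈p-y⇒x≢y _ i∈B′))) ⟩
    weightOf G w″ ((B ∪ ⁅ e ⁆) - e′) ≡⟨ weightOf-exchange G w″ e∉B e′∈B w″e≡w″e′ ⟩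
    weightOf G w″ B                   ∎
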